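{- Let $n$ be even, $d\ge1$, $H\sim\mathcal{G}_{\mathrm{reg}}(n,d)$, and $S=\{1,\dots,k\}\subseteq V=[n]$ with $k<n/2$; let $N=d(k-1)$. Then the martingale differences $Y_\ell=X_\ell-X_{\ell-1}$ of the matched edge-vertex reveal martingale $(X_\ell)_{\ell=0}^N$ satisfy $|Y_\ell|\le 1$ for all $\ell\in[N]$.
   Context: $\mathcal{G}_{\mathrm{reg}}(n,d)$ is the distribution of the multigraph on $[n]$ obtained as the disjoint union of $d$ independent uniformly random perfect matchings, indexed by $m\in[d]$. Fix an enumeration $((m_\ell,i_\ell))_{\ell=1}^N$ of $[d]\times[k-1]$, and let $Z_\ell\in[n]$ be the vertex to which matching $m_\ell$ matches $i_\ell$. Let $e(S)$ be the number of edges (with multiplicity) with both endpoints in $S$; note $e(S)=\sum_{\ell=1}^N\mathbf{1}\{Z_\ell\in[k]\text{ and }Z_\ell>i_\ell\}$. The matched edge-vertex reveal martingale is the Doob martingale $X_0=\mathbb{E}[e(S)]$, $X_\ell=\mathbb{E}[e(S)\mid Z_1,\dots,Z_\ell]$. -}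

module Defs where

open import Data.Bool using (Bool; true; false; _∧_; if_then_else_)
open import Data.Nat using (ℕ; zero; suc; _+_; _*_; _∸_; _<ᵇ_; _≡ᵇ_; _<?_)
open import Data.Fin using (Fin; zero; suc; toℕ; fromℕ<)
open import Data.Fin.Properties using (all?; _≟_)
open import Data.List using (List; []; _∷_; map; concatMap; filter; filterᵇ; length; upTo; allFin)
open import Data.Nat.ListAction using (sum)
open import Data.Bool.ListAction using (all)
open import Data.Product using (_×_; _,_; proj₁; proj₂)
open import Data.Integer using (+_)
open import Data.Rational using (ℚ; _/_; 0ℚ)
open import Relation.Nullary using (¬_; yes; no)
open import Relation.Nullary.Decidable using (_×-dec_; ¬?)
open import Relation.Binary.PropositionalEquality using (_≡_; _≢_)
open import Function.Bundles using (_↔_; Inverse)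

-- A perfect matching on the vertex set [n] (represented as Fin n, vertex v+1 ↦ v):
-- a fixed-point-free involution M, where M i is the partner of i.
IsPerfectMatching : {n : ℕ} → (Fin n → Fin n) → Set
IsPerfectMatching {n} M = ∀ i → (M i ≢ i) × (M (M i) ≡ i)

consF : {A : Set} {m : ℕ} → A → (Fin m → A) → Fin (suc m) → A
consF a f zero = a
consF a f (suc i) = f i

allFuns : {A : Set} → (m : ℕ) → List A → List (Fin m → A)
allFuns zero xs = (λ ()) ∷ []
allFuns (suc m) xs = concatMap (λ a → map (consF a) (allFuns m xs)) xs

perfectMatchings : (n : ℕ) → List (Fin n → Fin n)
perfectMatchings n =
  filter (λ M → all? (λ i → ¬? (M i ≟ i) ×-dec (M (M i) ≟ i))) (allFuns n (allFin n))

-- An outcome of G_reg(n,d): a d-tuple of perfect matchings (matching m ∈ [d]).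
Outcome : ℕ → ℕ → Set
Outcome n d = Fin d → Fin n → Fin n

-- The sample space: all d-tuples of perfect matchings; the product of d independent
-- uniform perfect matchings is the uniform distribution on this list.
sampleSpace : (n d : ℕ) → List (Outcome n d)
sampleSpace n d = allFuns d (perfectMatchings n)

-- partner of vertex v (as a natural number, 0-based) in matching M; default v if v ∉ [n]
partner : {n : ℕ} → (Fin n → Fin n) → ℕ → ℕ
partner {n} M v with v <? n
... | yes p = toℕ (M (fromℕ< p))
... | no _ = v

-- e(S) for S = {1..k} (0-based {0..k-1}): number of edges with multiplicity with
-- both endpoints in S; edge {u,v} of matching m counted once via u < v.
eS : {n d : ℕ} → ℕ → Outcome n d → ℕ
eS {n} {d} k ω =
  sum (concatMap (λ m → concatMap (λ u → map (λ v →
        if (u <ᵇ v) ∧ (partner (ω m) u ≡ᵇ v) then 1 else 0) (upTo k)) (upTo k)) (allFin d))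

-- mean of a list of naturals as a rational (0 for the empty list)
mean : List ℕ → ℚ
mean [] = 0ℚ
mean (x ∷ xs) = (+ sum (x ∷ xs)) / length (x ∷ xs)

-- the revealed value Z_ℓ: vertex matched to i_ℓ by matching m_ℓ, where
-- (m_ℓ , i_ℓ) = enum ℓ and i ∈ Fin (k-1) denotes vertex i+1 ∈ [k-1] (0-based: i).
Z : {n d : ℕ} (k : ℕ) → (Fin (d * (k ∸ 1)) ↔ (Fin d × Fin (k ∸ 1))) →
    Fin (d * (k ∸ 1)) → Outcome n d → ℕ
Z k enum ℓ ω = partner (ω (proj₁ (Inverse.to enum ℓ))) (toℕ (proj₂ (Inverse.to enum ℓ)))

-- ω' agrees with ω on Z_1, …, Z_j (0-based indices t < j)
agrees : {n d : ℕ} (k : ℕ) → (Fin (d * (k ∸ 1)) ↔ (Fin d × Fin (k ∸ 1))) →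
         ℕ → Outcome n d → Outcome n d → Bool
agrees {d = d} k enum j ω ω' =
  all (λ t → if toℕ t <ᵇ j then Z k enum t ω' ≡ᵇ Z k enum t ω else true) (allFin (d * (k ∸ 1)))

-- the matched edge-vertex reveal martingale X_j = E[e(S) | Z_1..Z_j], evaluated at ω
X : (n d k : ℕ) → (Fin (d * (k ∸ 1)) ↔ (Fin d × Fin (k ∸ 1))) →
    ℕ → Outcome n d → ℚ
X n d k enum j ω = mean (map (eS k) (filterᵇ (agrees k enum j ω) (sampleSpace n d)))

module Submission where

-- Fix a step ℓ, revealing Z_ℓ = partner of i₀ in matching m₀, and an outcome ω.  Let C be the
-- outcomes consistent with the reveals of ω before step ℓ and D ⊆ C those consistent up to step ℓ,
-- so that X_ℓ = mean of e(S) over C and X_{ℓ+1} = mean of e(S) over D.  For a ∈ C let switchBy a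
-- conjugate matching m₀ by the transposition (Z_ℓ(a), Z_ℓ(ω)).  The map φ (a , b) = (switchBy a b ,
-- switchBy a a) is an involution of C × D, and e(switchBy a a) is within one of e(a), because a
-- switching replaces two edges by two edges and i₀ ∈ S.  Summing over C × D and reindexing along φ
-- gives |D|·∑_C e(S) and |C|·∑_D e(S) within |C|·|D| of each other, i.e. |X_{ℓ+1} − X_ℓ| ≤ 1.

open import Defs
open import Data.Nat using (ℕ; zero; suc; _+_; _*_; _∸_; _≤_; _<_; z≤n; s≤s; _<ᵇ_; _≡ᵇ_; _<?_)
import Data.Nat as ℕ
import Data.Nat.Properties as ℕₚ
open import Data.Nat.Divisibility using (_∣_)
open import Data.Nat.ListAction using (sum)
open import Data.Nat.ListAction.Properties using (sum-++)
open import Data.Nat.Tactic.RingSolver using (solve-∀)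
open import Data.Bool using (Bool; true; false; _∧_; if_then_else_; T)
open import Data.Bool.Properties using (T-≡)
open import Data.Fin using (Fin; zero; suc; toℕ; fromℕ<)
open import Data.Fin.Permutation.Components using (transpose)
import Data.Fin.Properties as Finₚ
open import Data.List using (List; []; _∷_; map; concatMap; _++_; length; tabulate; allFin; upTo; filter; filterᵇ; cartesianProduct; _∷ʳ_)
open import Data.List.Properties using (upTo-∷ʳ; map-tabulate; length-map)
open import Data.List.Relation.Unary.All as All using (All; []; _∷_)
import Data.List.Relation.Unary.All.Properties as Allₚ
open import Data.List.Membership.Propositional using (_∈_; _∉_)
open import Data.List.Membership.Propositional.Properties using (∈-allFin)
open import Data.List.Relation.Unary.Any using (here; there)
open import Data.List.Relation.Unary.Unique.Propositional using (Unique)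
open import Data.List.Relation.Unary.AllPairs using ([]; _∷_)
open import Data.Product using (_×_; _,_; proj₁; proj₂; swap)
open import Data.Product.Relation.Binary.Pointwise.NonDependent using (Pointwise; ×-decidable)
open import Data.Vec.Functional.Relation.Binary.Pointwise.Properties using (decidable)
open import Relation.Nullary.Decidable using (_×-dec_)
open import Data.Empty using (⊥-elim)
open import Data.Sum using (_⊎_; inj₁; inj₂)
open import Function using (_∘_; id; mk⇔)
open import Function.Bundles using (_↔_; Inverse; Equivalence)
open import Level using (0ℓ)
open import Relation.Nullary using (Dec; yes; no; does; ¬_)
open import Relation.Nullary.Decidable using (does-⇔; dec-true; dec-false; from-yes)
open import Relation.Unary using (Pred)
import Relation.Unary as U
open import Relation.Binary using (Rel; Decidable; DecidableEquality; tri<; tri≈; tri>)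
open import Relation.Binary.PropositionalEquality
open import Data.Rational using (∣_∣; _-_; 1ℚ)
import Data.Rational as ℚ
import Data.Rational.Properties as ℚₚ
import Data.Rational.Unnormalised as ℚᵘ
import Data.Rational.Unnormalised.Properties as ℚᵘₚ
import Data.Integer as ℤ
import Data.Integer.Properties as ℤₚ

ind : Bool → ℕ
ind true = 1
ind false = 0

ind-∧ : ∀ a b → ind (a ∧ b) ≡ ind a * ind b
ind-∧ true b = sym (ℕₚ.+-identityʳ (ind b))
ind-∧ false b = refl

private
  variable
    A B : Set

∑ : List A → (A → ℕ) → ℕ
∑ xs f = sum (map f xs)

syntax ∑ xs (λ x → e) = ∑[ x ∈ xs ] e

∑-congᴬ : {f g : A → ℕ} (xs : List A) → All (λ x → f x ≡ g x) xs → ∑ xs f ≡ ∑ xs g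
∑-congᴬ [] [] = refl
∑-congᴬ (x ∷ xs) (p ∷ ps) = cong₂ _+_ p (∑-congᴬ xs ps)

∑-cong : {f g : A → ℕ} (xs : List A) → (∀ x → f x ≡ g x) → ∑ xs f ≡ ∑ xs g
∑-cong xs h = ∑-congᴬ xs (All.universal h xs)

∑-mono : {f g : A → ℕ} (xs : List A) → All (λ x → f x ≤ g x) xs → ∑ xs f ≤ ∑ xs g
∑-mono [] [] = z≤n
∑-mono (x ∷ xs) (p ∷ ps) = ℕₚ.+-mono-≤ p (∑-mono xs ps)

∑-+ : (f g : A → ℕ) (xs : List A) → ∑[ x ∈ xs ] (f x + g x) ≡ ∑ xs f + ∑ xs g
∑-+ f g [] = refl
∑-+ f g (x ∷ xs) = trans (cong (f x + g x +_) (∑-+ f g xs)) (interchange (f x) (g x) _ _)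
  where
  interchange : ∀ a b c d → (a + b) + (c + d) ≡ (a + c) + (b + d)
  interchange = solve-∀

∑-*ˡ : (c : ℕ) (f : A → ℕ) (xs : List A) → ∑[ x ∈ xs ] (c * f x) ≡ c * ∑ xs f
∑-*ˡ c f [] = sym (ℕₚ.*-zeroʳ c)
∑-*ˡ c f (x ∷ xs) = trans (cong (c * f x +_) (∑-*ˡ c f xs)) (sym (ℕₚ.*-distribˡ-+ c (f x) _))

∑-*ʳ : (c : ℕ) (f : A → ℕ) (xs : List A) → ∑[ x ∈ xs ] (f x * c) ≡ ∑ xs f * c
∑-*ʳ c f xs = trans (∑-cong xs (λ x → ℕₚ.*-comm (f x) c)) (trans (∑-*ˡ c f xs) (ℕₚ.*-comm c _))

∑-const : (c : ℕ) (xs : List A) → ∑[ _ ∈ xs ] c ≡ length xs * c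
∑-const c [] = refl
∑-const c (x ∷ xs) = cong (c +_) (∑-const c xs)

∑-++ : (f : A → ℕ) (xs ys : List A) → ∑ (xs ++ ys) f ≡ ∑ xs f + ∑ ys f
∑-++ f [] ys = refl
∑-++ f (x ∷ xs) ys = trans (cong (f x +_) (∑-++ f xs ys)) (sym (ℕₚ.+-assoc (f x) _ _))

sum-concatMap : (g : B → List ℕ) (xs : List B) → sum (concatMap g xs) ≡ ∑[ x ∈ xs ] sum (g x)
sum-concatMap g [] = refl
sum-concatMap g (x ∷ xs) = trans (sum-++ (g x) (concatMap g xs)) (cong (sum (g x) +_) (sum-concatMap g xs))

∑-map : (f : B → ℕ) (g : A → B) (xs : List A) → ∑ (map g xs) f ≡ ∑[ x ∈ xs ] f (g x)
∑-map f g [] = refl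
∑-map f g (x ∷ xs) = cong (f (g x) +_) (∑-map f g xs)

∑-concatMap : (f : B → ℕ) (g : A → List B) (xs : List A) → ∑ (concatMap g xs) f ≡ ∑[ x ∈ xs ] ∑ (g x) f
∑-concatMap f g [] = refl
∑-concatMap f g (x ∷ xs) = trans (∑-++ f (g x) (concatMap g xs)) (cong (∑ (g x) f +_) (∑-concatMap f g xs))

∑-swap : (F : A → B → ℕ) (xs : List A) (ys : List B) →
  ∑[ x ∈ xs ] ∑[ y ∈ ys ] F x y ≡ ∑[ y ∈ ys ] ∑[ x ∈ xs ] F x y
∑-swap F [] ys = sym (trans (∑-const 0 ys) (ℕₚ.*-zeroʳ (length ys)))
∑-swap F (x ∷ xs) ys = trans (cong (∑ ys (F x) +_) (∑-swap F xs ys)) (sym (∑-+ (F x) _ ys))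

∑-cartesianProduct : (F : A × B → ℕ) (xs : List A) (ys : List B) →
  ∑ (cartesianProduct xs ys) F ≡ ∑[ x ∈ xs ] ∑[ y ∈ ys ] F (x , y)
∑-cartesianProduct F [] ys = refl
∑-cartesianProduct F (x ∷ xs) ys =
  trans (∑-++ F (map (x ,_) ys) (cartesianProduct xs ys))
    (cong₂ _+_ (∑-map F (x ,_) ys) (∑-cartesianProduct F xs ys))

count : {_≈_ : Rel A 0ℓ} → Decidable _≈_ → List A → A → ℕ
count _≈?_ L x = ∑[ y ∈ L ] ind (does (y ≈? x))

module _ {_≈_ : Rel A 0ℓ} (_≈?_ : Decidable _≈_) where

  count-weighted : (g : A → ℕ) → (∀ {y z} → y ≈ z → g y ≡ g z) → (L : List A) (x : A) →
    ∑[ y ∈ L ] (ind (does (y ≈? x)) * g y) ≡ count _≈?_ L x * g x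
  count-weighted g resp [] x = refl
  count-weighted g resp (y ∷ L) x with y ≈? x
  ... | yes y≈x = cong₂ _+_ (trans (ℕₚ.+-identityʳ (g y)) (resp y≈x)) (count-weighted g resp L x)
  ... | no _ = count-weighted g resp L x

  -- Reindexing a sum along a map φ that is self-inverse on L up to ≈ and hits every entry of L
  -- exactly once: then ∑ (g ∘ φ) = ∑ g.  This is the double-counting principle behind switchings.
  ∑-reindex : (L : List A) (φ : A → A) (g : A → ℕ) → (∀ {y z} → y ≈ z → g y ≡ g z) →
    (∀ {x} → x ∈ L → count _≈?_ L (φ x) ≡ 1) →
    (∀ {x y} → x ∈ L → y ∈ L → y ≈ φ x → x ≈ φ y) →
    ∑[ x ∈ L ] g (φ x) ≡ ∑ L g
  ∑-reindex L φ g resp once self-inverse =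
    begin
      ∑[ x ∈ L ] g (φ x)
    ≡⟨ ∑-congᴬ L (All.tabulate λ {x} x∈ → sym (trans (cong (_* g (φ x)) (once x∈)) (ℕₚ.*-identityˡ (g (φ x))))) ⟩
      ∑[ x ∈ L ] (count _≈?_ L (φ x) * g (φ x))
    ≡⟨ ∑-cong L (λ x → sym (count-weighted g resp L (φ x))) ⟩
      ∑[ x ∈ L ] ∑[ y ∈ L ] (ind (does (y ≈? φ x)) * g y)
    ≡⟨ ∑-swap (λ x y → ind (does (y ≈? φ x)) * g y) L L ⟩
      ∑[ y ∈ L ] ∑[ x ∈ L ] (ind (does (y ≈? φ x)) * g y)
    ≡⟨ ∑-congᴬ L (All.tabulate λ {y} y∈ → ∑-congᴬ L (All.tabulate λ {x} x∈ →
         cong (λ b → ind b * g y) (does-⇔ (mk⇔ (self-inverse x∈ y∈) (self-inverse y∈ x∈)) (y ≈? φ x) (x ≈? φ y)))) ⟩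
      ∑[ y ∈ L ] ∑[ x ∈ L ] (ind (does (x ≈? φ y)) * g y)
    ≡⟨ ∑-cong L (λ y → ∑-*ʳ (g y) (λ x → ind (does (x ≈? φ y))) L) ⟩
      ∑[ y ∈ L ] (count _≈?_ L (φ y) * g y)
    ≡⟨ ∑-congᴬ L (All.tabulate λ {y} y∈ → trans (cong (_* g y) (once y∈)) (ℕₚ.*-identityˡ (g y))) ⟩
      ∑ L g
    ∎
    where open ≡-Reasoning

  count-filter : {P : Pred A 0ℓ} (P? : U.Decidable P) (L : List A) (x : A) →
    (∀ {y} → y ≈ x → P y) → count _≈?_ (filter P? L) x ≡ count _≈?_ L x
  count-filter P? [] x closed = refl
  count-filter P? (y ∷ L) x closed with P? y
  ... | yes _ = cong (ind (does (y ≈? x)) +_) (count-filter P? L x closed)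
  ... | no ¬Py with y ≈? x
  ...   | yes y≈x = ⊥-elim (¬Py (closed y≈x))
  ...   | no _ = count-filter P? L x closed

  count-allFuns : (m : ℕ) (xs : List A) (g : Fin m → A) → (∀ i → count _≈?_ xs (g i) ≡ 1) →
    count (decidable _≈?_) (allFuns m xs) g ≡ 1
  count-allFuns zero xs g once = refl
  count-allFuns (suc m) xs g once =
    begin
      count (decidable _≈?_) (allFuns (suc m) xs) g
    ≡⟨ ∑-concatMap (λ f → ind (does (decidable _≈?_ f g))) (λ a → map (consF a) (allFuns m xs)) xs ⟩
      ∑[ a ∈ xs ] ∑ (map (consF a) (allFuns m xs)) (λ f → ind (does (decidable _≈?_ f g)))
    ≡⟨ ∑-cong xs (λ a → ∑-map _ (consF a) (allFuns m xs)) ⟩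
      ∑[ a ∈ xs ] ∑[ f ∈ allFuns m xs ] ind (does (a ≈? g zero) ∧ does (decidable _≈?_ f (g ∘ suc)))
    ≡⟨ ∑-cong xs (λ a → ∑-cong (allFuns m xs) (λ f → ind-∧ (does (a ≈? g zero)) _)) ⟩
      ∑[ a ∈ xs ] ∑[ f ∈ allFuns m xs ] (ind (does (a ≈? g zero)) * ind (does (decidable _≈?_ f (g ∘ suc))))
    ≡⟨ ∑-cong xs (λ a → ∑-*ˡ (ind (does (a ≈? g zero))) _ (allFuns m xs)) ⟩
      ∑[ a ∈ xs ] (ind (does (a ≈? g zero)) * count (decidable _≈?_) (allFuns m xs) (g ∘ suc))
    ≡⟨ ∑-*ʳ _ (λ a → ind (does (a ≈? g zero))) xs ⟩
      count _≈?_ xs (g zero) * count (decidable _≈?_) (allFuns m xs) (g ∘ suc)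
    ≡⟨ cong₂ _*_ (once zero) (count-allFuns m xs (g ∘ suc) (once ∘ suc)) ⟩
      1
    ∎
    where open ≡-Reasoning

count-cartesianProduct : {_≈₁_ : Rel A 0ℓ} {_≈₂_ : Rel B 0ℓ} (_≈₁?_ : Decidable _≈₁_) (_≈₂?_ : Decidable _≈₂_)
  (xs : List A) (ys : List B) (x : A) (y : B) →
  count (×-decidable _≈₁?_ _≈₂?_) (cartesianProduct xs ys) (x , y) ≡ count _≈₁?_ xs x * count _≈₂?_ ys y
count-cartesianProduct _≈₁?_ _≈₂?_ xs ys x y =
  begin
    count (×-decidable _≈₁?_ _≈₂?_) (cartesianProduct xs ys) (x , y)
  ≡⟨ ∑-cartesianProduct _ xs ys ⟩
    ∑[ a ∈ xs ] ∑[ b ∈ ys ] ind (does (a ≈₁? x) ∧ does (b ≈₂? y))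
  ≡⟨ ∑-cong xs (λ a → ∑-cong ys (λ b → ind-∧ (does (a ≈₁? x)) _)) ⟩
    ∑[ a ∈ xs ] ∑[ b ∈ ys ] (ind (does (a ≈₁? x)) * ind (does (b ≈₂? y)))
  ≡⟨ ∑-cong xs (λ a → ∑-*ˡ (ind (does (a ≈₁? x))) _ ys) ⟩
    ∑[ a ∈ xs ] (ind (does (a ≈₁? x)) * count _≈₂?_ ys y)
  ≡⟨ ∑-*ʳ _ (λ a → ind (does (a ≈₁? x))) xs ⟩
    count _≈₁?_ xs x * count _≈₂?_ ys y
  ∎
  where open ≡-Reasoning

∑-allFin-suc : (n : ℕ) (f : Fin (suc n) → ℕ) → ∑ (tabulate {n = n} suc) f ≡ ∑[ i ∈ allFin n ] f (suc i)
∑-allFin-suc n f = trans (cong (λ L → ∑ L f) (sym (map-tabulate id suc))) (∑-map f suc (allFin n))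

count-allFin : (n : ℕ) (x : Fin n) → count Finₚ._≟_ (allFin n) x ≡ 1
count-allFin (suc n) zero =
  cong suc (trans (∑-allFin-suc n _) (trans (∑-const 0 (allFin n)) (ℕₚ.*-zeroʳ (length (allFin n)))))
count-allFin (suc n) (suc x) = trans (∑-allFin-suc n _) (count-allFin n x)

count-upTo : (k p : ℕ) → count ℕ._≟_ (upTo k) p ≡ ind (p <ᵇ k)
count-upTo zero p = refl
count-upTo (suc k) p =
  begin
    count ℕ._≟_ (upTo (suc k)) p
  ≡⟨ cong (λ L → count ℕ._≟_ L p) (sym (upTo-∷ʳ k)) ⟩
    count ℕ._≟_ (upTo k ∷ʳ k) p
  ≡⟨ ∑-++ _ (upTo k) (k ∷ []) ⟩
    count ℕ._≟_ (upTo k) p + (ind (k ≡ᵇ p) + 0)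
  ≡⟨ cong₂ _+_ (count-upTo k p) (ℕₚ.+-identityʳ _) ⟩
    ind (p <ᵇ k) + ind (k ≡ᵇ p)
  ≡⟨ sym (<ᵇ-suc p k) ⟩
    ind (p <ᵇ suc k)
  ∎
  where
  open ≡-Reasoning
  <ᵇ-suc : ∀ p k → ind (p <ᵇ suc k) ≡ ind (p <ᵇ k) + ind (k ≡ᵇ p)
  <ᵇ-suc zero zero = refl
  <ᵇ-suc zero (suc k) = refl
  <ᵇ-suc (suc p) zero = refl
  <ᵇ-suc (suc p) (suc k) = <ᵇ-suc p k

module _ (_≟_ : DecidableEquality A) where
  open import Data.List.Membership.DecPropositional _≟_ using (_∈?_)

  private
    hits : List A → A → ℕ
    hits pts u = ∑[ p ∈ pts ] ind (does (u ≟ p))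

    hits-∉ : (pts : List A) {u : A} → u ∉ pts → hits pts u ≡ 0
    hits-∉ [] u∉ = refl
    hits-∉ (p ∷ pts) {u} u∉ with u ≟ p
    ... | yes u≡p = ⊥-elim (u∉ (here u≡p))
    ... | no _ = hits-∉ pts (u∉ ∘ there)

    hits-∈ : {pts : List A} {u : A} → Unique pts → u ∈ pts → hits pts u ≡ 1
    hits-∈ {p ∷ pts} {u} (p∉pts ∷ _) u∈ with u ≟ p
    hits-∈ {p ∷ pts} (p∉pts ∷ _) u∈ | yes refl = cong suc (hits-∉ pts (λ p∈pts → All.lookup p∉pts p∈pts refl))
    hits-∈ (_ ∷ uniq) (here u≡p) | no u≢p = ⊥-elim (u≢p u≡p)
    hits-∈ (_ ∷ uniq) (there u∈) | no _ = hits-∈ uniq u∈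

  ∑-local-change : (L pts : List A) (F G : A → ℕ) → Unique pts → (∀ u → u ∉ pts → F u ≡ G u) →
    ∑ L F + ∑[ p ∈ pts ] (count _≟_ L p * G p) ≡ ∑ L G + ∑[ p ∈ pts ] (count _≟_ L p * F p)
  ∑-local-change L pts F G uniq agree =
    begin
      ∑ L F + ∑[ p ∈ pts ] (count _≟_ L p * G p)
    ≡⟨ cong (∑ L F +_) (weights-at-pts G) ⟩
      ∑ L F + ∑[ u ∈ L ] (hits pts u * G u)
    ≡⟨ sym (∑-+ F _ L) ⟩
      ∑[ u ∈ L ] (F u + hits pts u * G u)
    ≡⟨ ∑-cong L pointwise ⟩
      ∑[ u ∈ L ] (G u + hits pts u * F u)
    ≡⟨ ∑-+ G _ L ⟩
      ∑ L G + ∑[ u ∈ L ] (hits pts u * F u)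
    ≡⟨ cong (∑ L G +_) (sym (weights-at-pts F)) ⟩
      ∑ L G + ∑[ p ∈ pts ] (count _≟_ L p * F p)
    ∎
    where
    open ≡-Reasoning
    weights-at-pts : (H : A → ℕ) → ∑[ p ∈ pts ] (count _≟_ L p * H p) ≡ ∑[ u ∈ L ] (hits pts u * H u)
    weights-at-pts H =
      begin
        ∑[ p ∈ pts ] (count _≟_ L p * H p)
      ≡⟨ ∑-cong pts (λ p → sym (count-weighted _≟_ H (cong H) L p)) ⟩
        ∑[ p ∈ pts ] ∑[ u ∈ L ] (ind (does (u ≟ p)) * H u)
      ≡⟨ ∑-swap _ pts L ⟩
        ∑[ u ∈ L ] ∑[ p ∈ pts ] (ind (does (u ≟ p)) * H u)
      ≡⟨ ∑-cong L (λ u → ∑-*ʳ (H u) (λ p → ind (does (u ≟ p))) pts) ⟩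
        ∑[ u ∈ L ] (hits pts u * H u)
      ∎
    pointwise : ∀ u → F u + hits pts u * G u ≡ G u + hits pts u * F u
    pointwise u with u ∈? pts
    ... | yes u∈ rewrite hits-∈ uniq u∈ | ℕₚ.*-identityˡ (G u) | ℕₚ.*-identityˡ (F u) = ℕₚ.+-comm (F u) (G u)
    ... | no u∉ rewrite agree u u∉ = refl

WithinOne : ℕ → ℕ → Set
WithinOne a b = a ≤ b + 1 × b ≤ a + 1

within-one? : ∀ a b → Dec (WithinOne a b)
within-one? a b = (a ℕ.≤? b + 1) ×-dec (b ℕ.≤? a + 1)

within-one-cancel : ∀ c c' A B → c + A ≡ c' + B → WithinOne A B → WithinOne c c'
within-one-cancel c c' A B eq (A≤B+1 , B≤A+1) = half c' c B A (sym eq) B≤A+1 , half c c' A B eq A≤B+1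
  where
  half : ∀ c c' A B → c + A ≡ c' + B → A ≤ B + 1 → c' ≤ c + 1
  half c c' A B eq A≤B+1 = ℕₚ.+-cancelʳ-≤ B c' (c + 1) (begin
      c' + B      ≡⟨ sym eq ⟩
      c + A       ≤⟨ ℕₚ.+-monoʳ-≤ c A≤B+1 ⟩
      c + (B + 1) ≡⟨ regroup c B ⟩
      c + 1 + B   ∎)
    where
    open ℕₚ.≤-Reasoning
    regroup : ∀ c B → c + (B + 1) ≡ c + 1 + B
    regroup = solve-∀

-- The boolean identity behind a single switching: y + z·w and z + y·w are within one.
within-one-bits : ∀ y z w → WithinOne (ind y + ind z * ind w) (ind z + ind y * ind w)
within-one-bits true true true = from-yes (within-one? 2 2)
within-one-bits true true false = from-yes (within-one? 1 1)
within-one-bits true false true = from-yes (within-one? 1 1)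
within-one-bits true false false = from-yes (within-one? 1 0)
within-one-bits false true true = from-yes (within-one? 1 1)
within-one-bits false true false = from-yes (within-one? 0 1)
within-one-bits false false true = from-yes (within-one? 0 0)
within-one-bits false false false = from-yes (within-one? 0 0)

module _ {n : ℕ} where

  transpose-matchˡ : (x y : Fin n) → transpose x y x ≡ y
  transpose-matchˡ x y rewrite dec-true (x Finₚ.≟ x) refl = refl

  transpose-matchʳ : (x y : Fin n) → transpose x y y ≡ x
  transpose-matchʳ x y with y Finₚ.≟ x
  ... | yes refl = refl
  ... | no _ rewrite dec-true (y Finₚ.≟ y) refl = refl

  transpose-fix : (x y w : Fin n) → (w ≡ x ⊎ w ≡ y → x ≡ y) → transpose x y w ≡ w
  transpose-fix x y w degenerate = cases (w Finₚ.≟ x) (w Finₚ.≟ y)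
    where
    cases : Dec (w ≡ x) → Dec (w ≡ y) → transpose x y w ≡ w
    cases (yes refl) _ = trans (transpose-matchˡ w y) (sym (degenerate (inj₁ refl)))
    cases (no _) (yes refl) = trans (transpose-matchʳ x w) (degenerate (inj₂ refl))
    cases (no w≢x) (no w≢y) rewrite dec-false (w Finₚ.≟ x) w≢x | dec-false (w Finₚ.≟ y) w≢y = refl

  transpose-fix-distinct : (x y w : Fin n) → w ≢ x → w ≢ y → transpose x y w ≡ w
  transpose-fix-distinct x y w w≢x w≢y = transpose-fix x y w λ where
    (inj₁ w≡x) → ⊥-elim (w≢x w≡x)
    (inj₂ w≡y) → ⊥-elim (w≢y w≡y)

  transpose-involutive : (x y w : Fin n) → transpose x y (transpose x y w) ≡ w
  transpose-involutive x y w = cases (w Finₚ.≟ x) (w Finₚ.≟ y)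
    where
    cases : Dec (w ≡ x) → Dec (w ≡ y) → transpose x y (transpose x y w) ≡ w
    cases (yes refl) _ = trans (cong (transpose w y) (transpose-matchˡ w y)) (transpose-matchʳ w y)
    cases (no _) (yes refl) = trans (cong (transpose x w) (transpose-matchʳ x w)) (transpose-matchˡ x w)
    cases (no w≢x) (no w≢y) = trans (cong (transpose x y) fixed) fixed
      where
      fixed : transpose x y w ≡ w
      fixed = transpose-fix-distinct x y w w≢x w≢y

  matching-injective : {M : Fin n → Fin n} → IsPerfectMatching M → ∀ {u v} → M u ≡ M v → u ≡ v
  matching-injective {M} perfect {u} {v} Mu≡Mv =
    trans (sym (proj₂ (perfect u))) (trans (cong M Mu≡Mv) (proj₂ (perfect v)))

  isPerfectMatching-resp : {M M' : Fin n → Fin n} → (∀ j → M j ≡ M' j) →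
    IsPerfectMatching M → IsPerfectMatching M'
  isPerfectMatching-resp {M} {M'} M≗M' perfect j =
    (λ M'j≡j → proj₁ (perfect j) (trans (M≗M' j) M'j≡j)) ,
    trans (sym (M≗M' (M' j))) (trans (cong M (sym (M≗M' j))) (proj₂ (perfect j)))

  conjugate-isPerfectMatching : (π : Fin n → Fin n) → (∀ w → π (π w) ≡ w) →
    {M : Fin n → Fin n} → IsPerfectMatching M → IsPerfectMatching (π ∘ M ∘ π)
  conjugate-isPerfectMatching π π-involutive {M} perfect j =
    (λ fixed → proj₁ (perfect (π j)) (trans (sym (π-involutive _)) (cong π fixed))) ,
    (begin
      π (M (π (π (M (π j))))) ≡⟨ cong (π ∘ M) (π-involutive (M (π j))) ⟩
      π (M (M (π j)))         ≡⟨ cong π (proj₂ (perfect (π j))) ⟩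
      π (π j)                 ≡⟨ π-involutive j ⟩
      j                       ∎)
    where open ≡-Reasoning

_≋_ : {n d : ℕ} → Rel (Outcome n d) 0ℓ
a ≋ b = ∀ m j → a m j ≡ b m j

_≋?_ : {n d : ℕ} → Decidable (_≋_ {n} {d})
_≋?_ = decidable (decidable Finₚ._≟_)

module _ {n d : ℕ} where

  switch : Fin d → Fin n → Fin n → Outcome n d → Outcome n d
  switch m x y a m' with m' Finₚ.≟ m
  ... | yes _ = transpose x y ∘ a m' ∘ transpose x y
  ... | no _ = a m'

  switch-at : ∀ m x y a j → switch m x y a m j ≡ transpose x y (a m (transpose x y j))
  switch-at m x y a j with m Finₚ.≟ m
  ... | yes _ = refl
  ... | no m≢m = ⊥-elim (m≢m refl)

  switch-off : ∀ m x y a {m'} j → m' ≢ m → switch m x y a m' j ≡ a m' j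
  switch-off m x y a {m'} j m'≢m with m' Finₚ.≟ m
  ... | yes m'≡m = ⊥-elim (m'≢m m'≡m)
  ... | no _ = refl

  switch-involutive : ∀ m x y a → switch m x y (switch m x y a) ≋ a
  switch-involutive m x y a m' j with m' Finₚ.≟ m
  ... | yes refl = begin
      transpose x y (switch m x y a m' (transpose x y j))
        ≡⟨ cong (transpose x y) (switch-at m x y a (transpose x y j)) ⟩
      transpose x y (transpose x y (a m' (transpose x y (transpose x y j))))
        ≡⟨ transpose-involutive x y _ ⟩
      a m' (transpose x y (transpose x y j))
        ≡⟨ cong (a m') (transpose-involutive x y j) ⟩
      a m' j ∎
    where open ≡-Reasoning
  ... | no m'≢m = switch-off m x y a j m'≢m

  switch-cong : ∀ m x y {a b} → a ≋ b → switch m x y a ≋ switch m x y b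
  switch-cong m x y a≋b m' j with m' Finₚ.≟ m
  ... | yes _ = cong (transpose x y) (a≋b m' _)
  ... | no _ = a≋b m' j

  switch-perfect : ∀ m x y {a} → (∀ m' → IsPerfectMatching (a m')) → ∀ m' → IsPerfectMatching (switch m x y a m')
  switch-perfect m x y perfect m' with m' Finₚ.≟ m
  ... | yes _ = conjugate-isPerfectMatching (transpose x y) (transpose-involutive x y) (perfect m')
  ... | no _ = perfect m'

-- Rewiring the perfect matching M along the transposition (z y), where z = M i and y ∉ {i, z}:
-- the edges {i, z} and {y, w} (w = M y) become {i, y} and {z, w}; all other edges stay.
module Rewiring {n : ℕ} (M : Fin n → Fin n) (perfect : IsPerfectMatching M) (i y : Fin n)
                (y≢i : y ≢ i) (z≢y : M i ≢ y) where

  z w : Fin n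
  z = M i
  w = M y

  τ : Fin n → Fin n
  τ = transpose z y

  M' : Fin n → Fin n
  M' = τ ∘ M ∘ τ

  i≢z : i ≢ z
  i≢z = proj₁ (perfect i) ∘ sym
  i≢y : i ≢ y
  i≢y = y≢i ∘ sym
  i≢w : i ≢ w
  i≢w i≡w = z≢y (trans (cong M i≡w) (proj₂ (perfect y)))
  z≢w : z ≢ w
  z≢w = y≢i ∘ sym ∘ matching-injective perfect
  y≢w : y ≢ w
  y≢w = proj₁ (perfect y) ∘ sym

  private
    τi : τ i ≡ i
    τi = transpose-fix-distinct z y i i≢z i≢y
    τw : τ w ≡ w
    τw = transpose-fix-distinct z y w (z≢w ∘ sym) (y≢w ∘ sym)

  M'i : M' i ≡ y
  M'i = trans (cong (τ ∘ M) τi) (transpose-matchˡ z y)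
  M'y : M' y ≡ i
  M'y = trans (cong (τ ∘ M) (transpose-matchʳ z y)) (trans (cong τ (proj₂ (perfect i))) τi)
  M'z : M' z ≡ w
  M'z = trans (cong (τ ∘ M) (transpose-matchˡ z y)) τw
  M'w : M' w ≡ z
  M'w = trans (cong (τ ∘ M) τw) (trans (cong τ (proj₂ (perfect y))) (transpose-matchʳ z y))

  M'-elsewhere : ∀ U → U ≢ i → U ≢ z → U ≢ y → U ≢ w → M' U ≡ M U
  M'-elsewhere U U≢i U≢z U≢y U≢w =
    trans (cong (τ ∘ M) (transpose-fix-distinct z y U U≢z U≢y))
          (transpose-fix-distinct z y (M U) (U≢i ∘ matching-injective perfect)
            (λ MU≡y → U≢w (trans (sym (proj₂ (perfect U))) (cong M MU≡y))))

<ᵇ-true : ∀ {a b} → a < b → (a <ᵇ b) ≡ true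
<ᵇ-true a<b = Equivalence.to T-≡ (ℕₚ.<⇒<ᵇ a<b)

<ᵇ-false : ∀ {a b} → ¬ a < b → (a <ᵇ b) ≡ false
<ᵇ-false {a} {b} a≮b with a <ᵇ b in eq
... | true = ⊥-elim (a≮b (ℕₚ.<ᵇ⇒< a b (Equivalence.from T-≡ eq)))
... | false = refl

-- An edge {a, b} is counted from exactly one endpoint, the smaller one, and it is counted
-- iff both endpoints lie in [k].
counted-once : ∀ k a b → a ≢ b →
  ind (a <ᵇ k) * ind ((a <ᵇ b) ∧ (b <ᵇ k)) + ind (b <ᵇ k) * ind ((b <ᵇ a) ∧ (a <ᵇ k))
    ≡ ind (a <ᵇ k) * ind (b <ᵇ k)
counted-once k a b a≢b with ℕₚ.<-cmp a b
... | tri< a<b _ b≮a rewrite <ᵇ-true a<b | <ᵇ-false b≮a =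
  trans (cong (ind (a <ᵇ k) * ind (b <ᵇ k) +_) (ℕₚ.*-zeroʳ (ind (b <ᵇ k)))) (ℕₚ.+-identityʳ _)
... | tri≈ _ a≡b _ = ⊥-elim (a≢b a≡b)
... | tri> a≮b _ b<a rewrite <ᵇ-false a≮b | <ᵇ-true b<a =
  trans (cong (_+ ind (b <ᵇ k) * ind (a <ᵇ k)) (ℕₚ.*-zeroʳ (ind (a <ᵇ k)))) (ℕₚ.*-comm (ind (b <ᵇ k)) _)

module _ {n : ℕ} where

  partner-toℕ : (M : Fin n → Fin n) (x : Fin n) → partner M (toℕ x) ≡ toℕ (M x)
  partner-toℕ M x with toℕ x <? n
  ... | yes x<n = cong (toℕ ∘ M) (Finₚ.fromℕ<-toℕ x x<n)
  ... | no x≮n = ⊥-elim (x≮n (Finₚ.toℕ<n x))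

  partner-cong : (M M' : Fin n → Fin n) (u : ℕ) → (∀ U → toℕ U ≡ u → M U ≡ M' U) → partner M u ≡ partner M' u
  partner-cong M M' u agree with u <? n
  ... | yes u<n = cong toℕ (agree (fromℕ< u<n) (Finₚ.toℕ-fromℕ< u<n))
  ... | no _ = refl

module EdgesInside (n k : ℕ) where

  countedAt : (Fin n → Fin n) → ℕ → ℕ
  countedAt M u = ind ((u <ᵇ partner M u) ∧ (partner M u <ᵇ k))

  inside : (Fin n → Fin n) → ℕ
  inside M = ∑[ u ∈ upTo k ] countedAt M u

  inside-cong : (M M' : Fin n → Fin n) → (∀ j → M j ≡ M' j) → inside M ≡ inside M'
  inside-cong M M' M≗M' = ∑-cong (upTo k) λ u →
    cong (λ p → ind ((u <ᵇ p) ∧ (p <ᵇ k))) (partner-cong M M' u (λ U _ → M≗M' U))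

  eS-decomposition : {d : ℕ} (a : Outcome n d) → eS k a ≡ ∑[ m ∈ allFin d ] inside (a m)
  eS-decomposition {d} a =
    trans (sum-concatMap _ (allFin d)) (∑-cong (allFin d) λ m →
      trans (sum-concatMap _ (upTo k)) (∑-cong (upTo k) λ u → edge-from u (partner (a m) u)))
    where
    edge-from : ∀ u p → ∑[ v ∈ upTo k ] (if (u <ᵇ v) ∧ (p ≡ᵇ v) then 1 else 0) ≡ ind ((u <ᵇ p) ∧ (p <ᵇ k))
    edge-from u p =
      begin
        ∑[ v ∈ upTo k ] (if (u <ᵇ v) ∧ (p ≡ᵇ v) then 1 else 0)
      ≡⟨ ∑-cong (upTo k) (λ v → as-product (u <ᵇ v) (p ≡ᵇ v)) ⟩
        ∑[ v ∈ upTo k ] (ind (p ≡ᵇ v) * ind (u <ᵇ v))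
      ≡⟨ ∑-cong (upTo k) (λ v → cong (λ b → ind b * ind (u <ᵇ v)) (does-⇔ (mk⇔ sym sym) (p ℕ.≟ v) (v ℕ.≟ p))) ⟩
        ∑[ v ∈ upTo k ] (ind (does (v ℕ.≟ p)) * ind (u <ᵇ v))
      ≡⟨ count-weighted ℕ._≟_ (λ v → ind (u <ᵇ v)) (cong (λ v → ind (u <ᵇ v))) (upTo k) p ⟩
        count ℕ._≟_ (upTo k) p * ind (u <ᵇ p)
      ≡⟨ cong (_* ind (u <ᵇ p)) (count-upTo k p) ⟩
        ind (p <ᵇ k) * ind (u <ᵇ p)
      ≡⟨ trans (ℕₚ.*-comm (ind (p <ᵇ k)) _) (sym (ind-∧ (u <ᵇ p) (p <ᵇ k))) ⟩
        ind ((u <ᵇ p) ∧ (p <ᵇ k))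
      ∎
      where
      open ≡-Reasoning
      as-product : ∀ b c → (if b ∧ c then 1 else 0) ≡ ind c * ind b
      as-product true true = refl
      as-product true false = refl
      as-product false true = refl
      as-product false false = refl

  eS-cong : {d : ℕ} {a b : Outcome n d} → a ≋ b → eS k a ≡ eS k b
  eS-cong {d} {a} {b} a≋b = trans (eS-decomposition a)
    (trans (∑-cong (allFin d) (λ m → inside-cong (a m) (b m) (a≋b m))) (sym (eS-decomposition b)))

  countedAt-edge : (M : Fin n → Fin n) {u v : Fin n} → M u ≡ v →
    countedAt M (toℕ u) ≡ ind ((toℕ u <ᵇ toℕ v) ∧ (toℕ v <ᵇ k))
  countedAt-edge M {u} Mu≡v = cong (λ p → ind ((toℕ u <ᵇ p) ∧ (p <ᵇ k))) (trans (partner-toℕ M u) (cong toℕ Mu≡v))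

  edge-counted-once : (M : Fin n → Fin n) {a b : Fin n} → M a ≡ b → M b ≡ a → a ≢ b →
    count ℕ._≟_ (upTo k) (toℕ a) * countedAt M (toℕ a) + count ℕ._≟_ (upTo k) (toℕ b) * countedAt M (toℕ b)
      ≡ ind (toℕ a <ᵇ k) * ind (toℕ b <ᵇ k)
  edge-counted-once M {a} {b} Ma≡b Mb≡a a≢b =
    trans (cong₂ _+_ (cong₂ _*_ (count-upTo k (toℕ a)) (countedAt-edge M Ma≡b))
                     (cong₂ _*_ (count-upTo k (toℕ b)) (countedAt-edge M Mb≡a)))
          (counted-once k (toℕ a) (toℕ b) (a≢b ∘ Finₚ.toℕ-injective))

  -- Only the four vertices
  -- i, M i, y, M y change partners, so by the local-change formula the change is
  -- [y ∈ S] + [M i ∈ S]·[M y ∈ S] − [M i ∈ S] − [y ∈ S]·[M y ∈ S].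
  inside-switch : (M : Fin n → Fin n) → IsPerfectMatching M → (i y : Fin n) → toℕ i < k → y ≢ i →
    WithinOne (inside M) (inside (transpose (M i) y ∘ M ∘ transpose (M i) y))
  inside-switch M perfect i y i<k y≢i with M i Finₚ.≟ y
  ... | yes Mi≡y = within-one-≡ (inside-cong M _ λ j →
          sym (trans (transpose-fix (M i) y _ (λ _ → Mi≡y)) (cong M (transpose-fix (M i) y j (λ _ → Mi≡y)))))
    where
    within-one-≡ : ∀ {a b} → a ≡ b → WithinOne a b
    within-one-≡ {a} refl = ℕₚ.m≤m+n a 1 , ℕₚ.m≤m+n a 1
  ... | no z≢y = within-one-cancel (inside M) (inside M') _ _ balance (within-one-bits (y' <ᵇ k) (z' <ᵇ k) (w' <ᵇ k))
    where
    open Rewiring M perfect i y y≢i z≢y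
    i' z' y' w' : ℕ
    i' = toℕ i
    z' = toℕ z
    y' = toℕ y
    w' = toℕ w

    pts : List ℕ
    pts = i' ∷ z' ∷ y' ∷ w' ∷ []

    toℕ-≢ : {u v : Fin n} → u ≢ v → toℕ u ≢ toℕ v
    toℕ-≢ u≢v = u≢v ∘ Finₚ.toℕ-injective

    pts-unique : Unique pts
    pts-unique = (toℕ-≢ i≢z ∷ toℕ-≢ i≢y ∷ toℕ-≢ i≢w ∷ []) ∷ (toℕ-≢ z≢y ∷ toℕ-≢ z≢w ∷ []) ∷ (toℕ-≢ y≢w ∷ []) ∷ [] ∷ []

    agree-off-pts : ∀ u → u ∉ pts → countedAt M u ≡ countedAt M' u
    agree-off-pts u u∉ = cong (λ p → ind ((u <ᵇ p) ∧ (p <ᵇ k))) (partner-cong M M' u λ U U≡u →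
      let avoid : ∀ {v} → (u ≡ toℕ v → u ∈ pts) → U ≢ v
          avoid at U≡v = u∉ (at (trans (sym U≡u) (cong toℕ U≡v)))
      in sym (M'-elsewhere U (avoid here) (avoid (there ∘ here)) (avoid (there ∘ there ∘ here))
                             (avoid (there ∘ there ∘ there ∘ here))))

    weight : (Fin n → Fin n) → ℕ → ℕ
    weight N p = count ℕ._≟_ (upTo k) p * countedAt N p

    i∈S : ind (i' <ᵇ k) ≡ 1
    i∈S = cong ind (<ᵇ-true i<k)

    regroup₁ : ∀ a b c d → a + (b + (c + (d + 0))) ≡ (a + b) + (c + d)
    regroup₁ = solve-∀
    regroup₂ : ∀ a b c d → a + (b + (c + (d + 0))) ≡ (a + c) + (b + d)
    regroup₂ = solve-∀

    -- At the four points M has the edges {i, z} and {y, w}, while M' has {i, y} and {z, w}.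
    before : ∑[ p ∈ pts ] weight M p ≡ ind (z' <ᵇ k) + ind (y' <ᵇ k) * ind (w' <ᵇ k)
    before = trans (regroup₁ (weight M i') (weight M z') (weight M y') (weight M w'))
      (cong₂ _+_ (trans (edge-counted-once M refl (proj₂ (perfect i)) i≢z) (trans (cong (_* ind (z' <ᵇ k)) i∈S) (ℕₚ.*-identityˡ _)))
                 (edge-counted-once M refl (proj₂ (perfect y)) y≢w))
    after : ∑[ p ∈ pts ] weight M' p ≡ ind (y' <ᵇ k) + ind (z' <ᵇ k) * ind (w' <ᵇ k)
    after = trans (regroup₂ (weight M' i') (weight M' z') (weight M' y') (weight M' w'))
      (cong₂ _+_ (trans (edge-counted-once M' M'i M'y i≢y) (trans (cong (_* ind (y' <ᵇ k)) i∈S) (ℕₚ.*-identityˡ _)))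
                 (edge-counted-once M' M'z M'w z≢w))

    balance : inside M + (ind (y' <ᵇ k) + ind (z' <ᵇ k) * ind (w' <ᵇ k))
            ≡ inside M' + (ind (z' <ᵇ k) + ind (y' <ᵇ k) * ind (w' <ᵇ k))
    balance = begin
        inside M + (ind (y' <ᵇ k) + ind (z' <ᵇ k) * ind (w' <ᵇ k)) ≡⟨ cong (inside M +_) (sym after) ⟩
        inside M + ∑[ p ∈ pts ] weight M' p                         ≡⟨ ∑-local-change ℕ._≟_ (upTo k) pts _ _ pts-unique agree-off-pts ⟩
        inside M' + ∑[ p ∈ pts ] weight M p                         ≡⟨ cong (inside M' +_) before ⟩
        inside M' + (ind (z' <ᵇ k) + ind (y' <ᵇ k) * ind (w' <ᵇ k)) ∎
      where open ≡-Reasoning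

  eS-switch : {d : ℕ} (a : Outcome n d) → (∀ m → IsPerfectMatching (a m)) → (m : Fin d) (i y : Fin n) →
    toℕ i < k → y ≢ i → WithinOne (eS k a) (eS k (switch m (a m i) y a))
  eS-switch {d} a perfect m i y i<k y≢i =
    within-one-cancel (eS k a) (eS k b) _ _ balance (swap (inside-switch (a m) (perfect m) i y i<k y≢i))
    where
    b : Outcome n d
    b = switch m (a m i) y a
    F G : Fin d → ℕ
    F m' = inside (a m')
    G m' = inside (b m')
    agree-off-m : ∀ m' → m' ∉ m ∷ [] → F m' ≡ G m'
    agree-off-m m' m'∉ = inside-cong (a m') (b m') λ j → sym (switch-off m (a m i) y a j (m'∉ ∘ here))
    at-m : (H : Fin d → ℕ) → ∑[ p ∈ m ∷ [] ] (count Finₚ._≟_ (allFin d) p * H p) ≡ H m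
    at-m H = trans (ℕₚ.+-identityʳ _) (trans (cong (_* H m) (count-allFin d m)) (ℕₚ.*-identityˡ (H m)))
    balance : eS k a + inside (transpose (a m i) y ∘ a m ∘ transpose (a m i) y) ≡ eS k b + inside (a m)
    balance = begin
        eS k a + inside (transpose (a m i) y ∘ a m ∘ transpose (a m i) y)
          ≡⟨ cong₂ _+_ (eS-decomposition a) (inside-cong _ (b m) (sym ∘ switch-at m (a m i) y a)) ⟩
        ∑ (allFin d) F + G m
          ≡⟨ cong (∑ (allFin d) F +_) (sym (at-m G)) ⟩
        ∑ (allFin d) F + ∑[ p ∈ m ∷ [] ] (count Finₚ._≟_ (allFin d) p * G p)
          ≡⟨ ∑-local-change Finₚ._≟_ (allFin d) (m ∷ []) F G ([] ∷ []) agree-off-m ⟩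
        ∑ (allFin d) G + ∑[ p ∈ m ∷ [] ] (count Finₚ._≟_ (allFin d) p * F p)
          ≡⟨ cong₂ _+_ (sym (eS-decomposition b)) (at-m F) ⟩
        eS k b + inside (a m) ∎
      where open ≡-Reasoning

allFuns-values : {Q : A → Set} (m : ℕ) (xs : List A) → All Q xs → All (λ f → ∀ i → Q (f i)) (allFuns m xs)
allFuns-values zero xs Qxs = (λ ()) ∷ []
allFuns-values {Q = Q} (suc m) xs Qxs = Allₚ.concat⁺ (Allₚ.map⁺ (All.map extend Qxs))
  where
  extend : ∀ {a} → Q a → All (λ f → ∀ i → Q (f i)) (map (consF a) (allFuns m xs))
  extend Qa = Allₚ.map⁺ (All.map (λ Qf → λ { zero → Qa ; (suc i) → Qf i }) (allFuns-values m xs Qxs))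

module SampleSpace (n d : ℕ) where

  Perfect : Outcome n d → Set
  Perfect a = ∀ m → IsPerfectMatching (a m)

  sampleSpace-perfect : All Perfect (sampleSpace n d)
  sampleSpace-perfect = allFuns-values d (perfectMatchings n) (Allₚ.all-filter _ (allFuns n (allFin n)))

  count-sampleSpace : (a : Outcome n d) → Perfect a → count _≋?_ (sampleSpace n d) a ≡ 1
  count-sampleSpace a perfect = count-allFuns (decidable Finₚ._≟_) d (perfectMatchings n) a λ m →
    trans (count-filter (decidable Finₚ._≟_) _ (allFuns n (allFin n)) (a m)
                        (λ M≗am → isPerfectMatching-resp (sym ∘ M≗am) (perfect m)))
          (count-allFuns Finₚ._≟_ n (allFin n) (a m) (count-allFin n ∘ a m))

module RevealOrder (n d k : ℕ) (k-1<n : k ∸ 1 < n) (enum : Fin (d * (k ∸ 1)) ↔ (Fin d × Fin (k ∸ 1))) where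
  open SampleSpace n d

  Step : Set
  Step = Fin (d * (k ∸ 1))

  matchingOf : Step → Fin d
  matchingOf t = proj₁ (Inverse.to enum t)

  vertexOf : Step → Fin n
  vertexOf t = fromℕ< (ℕₚ.<-trans (Finₚ.toℕ<n (proj₂ (Inverse.to enum t))) k-1<n)

  toℕ-vertexOf : ∀ t → toℕ (vertexOf t) ≡ toℕ (proj₂ (Inverse.to enum t))
  toℕ-vertexOf t = Finₚ.toℕ-fromℕ< _

  vertexOf-in-S : ∀ t → toℕ (vertexOf t) < k
  vertexOf-in-S t = subst (_< k) (sym (toℕ-vertexOf t)) (ℕₚ.<-≤-trans (Finₚ.toℕ<n _) (ℕₚ.m∸n≤m k 1))

  slot-injective : ∀ s t → matchingOf s ≡ matchingOf t → vertexOf s ≡ vertexOf t → s ≡ t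
  slot-injective s t same-m same-i = begin
      s                                     ≡⟨ sym (Inverse.strictlyInverseʳ enum s) ⟩
      Inverse.from enum (Inverse.to enum s) ≡⟨ cong (Inverse.from enum) (cong₂ _,_ same-m same-slot) ⟩
      Inverse.from enum (Inverse.to enum t) ≡⟨ Inverse.strictlyInverseʳ enum t ⟩
      t                                     ∎
    where
    open ≡-Reasoning
    same-slot : proj₂ (Inverse.to enum s) ≡ proj₂ (Inverse.to enum t)
    same-slot = Finₚ.toℕ-injective (trans (sym (toℕ-vertexOf s)) (trans (cong toℕ same-i) (toℕ-vertexOf t)))

  revealed : Step → Outcome n d → Fin n
  revealed t a = a (matchingOf t) (vertexOf t)

  Z≡revealed : ∀ t a → Z k enum t a ≡ toℕ (revealed t a)
  Z≡revealed t a = trans (cong (partner (a (matchingOf t))) (sym (toℕ-vertexOf t))) (partner-toℕ (a (matchingOf t)) (vertexOf t))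

  AgreesBefore : ℕ → Outcome n d → Outcome n d → Set
  AgreesBefore j ω a = ∀ t → toℕ t < j → revealed t a ≡ revealed t ω

  agrees⇒ : ∀ j ω a → T (agrees k enum j ω a) → AgreesBefore j ω a
  agrees⇒ j ω a agree t t<j = Finₚ.toℕ-injective (begin
      toℕ (revealed t a) ≡⟨ sym (Z≡revealed t a) ⟩
      Z k enum t a       ≡⟨ ℕₚ.≡ᵇ⇒≡ _ _ (then-branch (All.lookup (Allₚ.all⁺ _ _ agree) (∈-allFin t)) (ℕₚ.<⇒<ᵇ t<j)) ⟩
      Z k enum t ω       ≡⟨ Z≡revealed t ω ⟩
      toℕ (revealed t ω) ∎)
    where
    open ≡-Reasoning
    then-branch : ∀ {b c} → T (if b then c else true) → T b → T c
    then-branch {true} Tc _ = Tc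

  agrees⇐ : ∀ j ω a → AgreesBefore j ω a → T (agrees k enum j ω a)
  agrees⇐ j ω a agree = Allₚ.all⁻ _ {xs = allFin (d * (k ∸ 1))} (All.tabulate λ {t} _ → guarded λ t<ᵇj →
    ℕₚ.≡⇒≡ᵇ _ _ (trans (Z≡revealed t a) (trans (cong toℕ (agree t (ℕₚ.<ᵇ⇒< _ _ t<ᵇj))) (sym (Z≡revealed t ω)))))
    where
    guarded : ∀ {b c} → (T b → T c) → T (if b then c else true)
    guarded {true} f = f _
    guarded {false} f = _

  consistent : ℕ → Outcome n d → List (Outcome n d)
  consistent j ω = filterᵇ (agrees k enum j ω) (sampleSpace n d)

  consistent-members : ∀ j ω → All (λ a → Perfect a × AgreesBefore j ω a) (consistent j ω)
  consistent-members j ω = All.map (λ {a} (perfect , agree) → perfect , agrees⇒ j ω a agree)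
    (All.zip (Allₚ.filter⁺ _ sampleSpace-perfect , Allₚ.all-filter _ (sampleSpace n d)))

  count-consistent : ∀ j ω a → Perfect a → AgreesBefore j ω a → count _≋?_ (consistent j ω) a ≡ 1
  count-consistent j ω a perfect agree =
    trans (count-filter _≋?_ _ (sampleSpace n d) a λ {b} b≋a →
            agrees⇐ j ω b λ t t<j → trans (b≋a (matchingOf t) (vertexOf t)) (agree t t<j))
          (count-sampleSpace a perfect)

module _ where
  open ℤ using (+_)
  open ℚᵘ using (mkℚᵘ; *≤*)

  ∣-∣-bound : ∀ x y z → x ≤ y + z → y ≤ x + z → ℤ.∣ + x ℤ.- + y ∣ ≤ z
  ∣-∣-bound x y z x≤y+z y≤x+z rewrite ℤₚ.m-n≡m⊖n x y with ℕₚ.≤-total x y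
  ... | inj₁ x≤y rewrite ℤₚ.∣⊖∣-≤ x≤y = ℕₚ.m≤n+o⇒m∸n≤o y x y≤x+z
  ... | inj₂ y≤x rewrite ℤₚ.∣m⊖n∣≡∣n⊖m∣ x y | ℤₚ.∣⊖∣-≤ y≤x = ℕₚ.m≤n+o⇒m∸n≤o x y x≤y+z

  fractions-within-one : ∀ a b c e → a * suc e ≤ c * suc b + suc b * suc e → c * suc b ≤ a * suc e + suc b * suc e →
    ℚᵘ.∣ mkℚᵘ (+ a) b ℚᵘ.- mkℚᵘ (+ c) e ∣ ℚᵘ.≤ ℚᵘ.1ℚᵘ
  fractions-within-one a b c e upper lower =
    *≤* (subst₂ ℤ._≤_ (sym (ℤₚ.*-identityʳ _)) (sym (ℤₚ.*-identityˡ _)) (ℤ.+≤+ numerator-bound))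
    where
    numerator≡ : (+ a) ℤ.* (+ suc e) ℤ.+ (ℤ.- (+ c)) ℤ.* (+ suc b) ≡ + (a * suc e) ℤ.- + (c * suc b)
    numerator≡ = cong₂ ℤ._+_ (sym (ℤₚ.pos-* a (suc e)))
      (trans (sym (ℤₚ.neg-distribˡ-* (+ c) (+ suc b))) (cong ℤ.-_ (sym (ℤₚ.pos-* c (suc b)))))
    numerator-bound : ℤ.∣ (+ a) ℤ.* (+ suc e) ℤ.+ (ℤ.- (+ c)) ℤ.* (+ suc b) ∣ ≤ suc b * suc e
    numerator-bound = subst (λ v → ℤ.∣ v ∣ ≤ suc b * suc e) (sym numerator≡) (∣-∣-bound _ _ _ upper lower)

  mean-within-one : ∀ (P Q : List ℕ) → 1 ≤ length P → 1 ≤ length Q →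
    length Q * sum P ≤ length P * sum Q + length P * length Q →
    length P * sum Q ≤ length Q * sum P + length P * length Q →
    ∣ mean Q - mean P ∣ ℚ.≤ 1ℚ
  mean-within-one P@(p ∷ P') Q@(q ∷ Q') _ _ boundP boundQ =
    ℚₚ.toℚᵘ-cancel-≤ (ℚᵘₚ.≤-respˡ-≃ (ℚᵘₚ.≃-sym as-fractions) (fractions-within-one (sum Q) (length Q') (sum P) (length P') upper lower))
    where
    as-fractions : ℚ.toℚᵘ ∣ mean Q - mean P ∣ ℚᵘ.≃ ℚᵘ.∣ mkℚᵘ (+ sum Q) (length Q') ℚᵘ.- mkℚᵘ (+ sum P) (length P') ∣
    as-fractions = ℚᵘₚ.≃-trans (ℚₚ.toℚᵘ-homo-∣-∣ (mean Q - mean P))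
      (ℚᵘₚ.≃-trans (ℚᵘₚ.∣-∣-cong (ℚₚ.toℚᵘ-homo-+ (mean Q) (ℚ.- mean P)))
        (ℚᵘₚ.∣-∣-cong (ℚᵘₚ.+-cong (ℚₚ.toℚᵘ-fromℚᵘ (mkℚᵘ (+ sum Q) (length Q')))
          (ℚᵘₚ.≃-trans (ℚₚ.toℚᵘ-homo‿- (mean P)) (ℚᵘₚ.-‿cong (ℚₚ.toℚᵘ-fromℚᵘ (mkℚᵘ (+ sum P) (length P'))))))))
    upper : sum Q * length P ≤ sum P * length Q + length Q * length P
    upper = subst₂ _≤_ (ℕₚ.*-comm (length P) (sum Q))
      (cong₂ _+_ (ℕₚ.*-comm (length Q) (sum P)) (ℕₚ.*-comm (length P) (length Q))) boundQ
    lower : sum P * length Q ≤ sum Q * length P + length Q * length P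
    lower = subst₂ _≤_ (ℕₚ.*-comm (length Q) (sum P))
      (cong₂ _+_ (ℕₚ.*-comm (length P) (sum Q)) (ℕₚ.*-comm (length P) (length Q))) boundP

module Switching (n d k : ℕ) (k-1<n : k ∸ 1 < n) (enum : Fin (d * (k ∸ 1)) ↔ (Fin d × Fin (k ∸ 1)))
                 (ω : Outcome n d) (ω-perfect : ∀ m → IsPerfectMatching (ω m)) (ℓ : Fin (d * (k ∸ 1))) where
  open SampleSpace n d
  open RevealOrder n d k k-1<n enum
  open EdgesInside n k

  m₀ : Fin d
  m₀ = matchingOf ℓ
  i₀ y₀ : Fin n
  i₀ = vertexOf ℓ
  y₀ = revealed ℓ ω

  InC InD : Outcome n d → Set
  InC a = Perfect a × AgreesBefore (toℕ ℓ) ω a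
  InD b = Perfect b × AgreesBefore (suc (toℕ ℓ)) ω b

  InD⇒InC : ∀ {b} → InD b → InC b
  InD⇒InC (perfect , agree) = perfect , λ t t<ℓ → agree t (ℕₚ.m<n⇒m<1+n t<ℓ)

  switchBy : Outcome n d → Outcome n d → Outcome n d
  switchBy a = switch m₀ (revealed ℓ a) y₀

  switchBy-fixes : ∀ {a} c → Perfect a → (j : Fin n) → j ≢ i₀ →
    a m₀ j ≡ ω m₀ j → c m₀ j ≡ ω m₀ j → switchBy a c m₀ j ≡ c m₀ j
  switchBy-fixes {a} c a-perfect j j≢i₀ aj≡ωj cj≡ωj = begin
      switchBy a c m₀ j                        ≡⟨ switch-at m₀ x y₀ c j ⟩
      transpose x y₀ (c m₀ (transpose x y₀ j)) ≡⟨ cong (transpose x y₀ ∘ c m₀) (transpose-fix x y₀ j j-degenerate) ⟩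
      transpose x y₀ (c m₀ j)                  ≡⟨ transpose-fix x y₀ (c m₀ j) cj-degenerate ⟩
      c m₀ j                                   ∎
    where
    open ≡-Reasoning
    x : Fin n
    x = a m₀ i₀
    j-degenerate : j ≡ x ⊎ j ≡ y₀ → x ≡ y₀
    j-degenerate (inj₁ j≡x) = trans (sym j≡x) (begin
      j                     ≡⟨ sym (proj₂ (ω-perfect m₀ j)) ⟩
      ω m₀ (ω m₀ j)         ≡⟨ cong (ω m₀) (sym aj≡ωj) ⟩
      ω m₀ (a m₀ j)         ≡⟨ cong (ω m₀ ∘ a m₀) j≡x ⟩
      ω m₀ (a m₀ (a m₀ i₀)) ≡⟨ cong (ω m₀) (proj₂ (a-perfect m₀ i₀)) ⟩
      y₀                    ∎)
    j-degenerate (inj₂ j≡y₀) = trans (begin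
      a m₀ i₀               ≡⟨ cong (a m₀) (sym (proj₂ (ω-perfect m₀ i₀))) ⟩
      a m₀ (ω m₀ y₀)        ≡⟨ cong (a m₀ ∘ ω m₀) (sym j≡y₀) ⟩
      a m₀ (ω m₀ j)         ≡⟨ cong (a m₀) (sym aj≡ωj) ⟩
      a m₀ (a m₀ j)         ≡⟨ proj₂ (a-perfect m₀ j) ⟩
      j                     ∎) j≡y₀
    cj-degenerate : c m₀ j ≡ x ⊎ c m₀ j ≡ y₀ → x ≡ y₀
    cj-degenerate (inj₁ cj≡x) = ⊥-elim (j≢i₀ (matching-injective (a-perfect m₀) (trans aj≡ωj (trans (sym cj≡ωj) cj≡x))))
    cj-degenerate (inj₂ cj≡y₀) = ⊥-elim (j≢i₀ (matching-injective (ω-perfect m₀) (trans (sym cj≡ωj) cj≡y₀)))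

  switchBy-preserves-earlier : ∀ {a c} → InC a → InC c → ∀ t → toℕ t < toℕ ℓ → revealed t (switchBy a c) ≡ revealed t c
  switchBy-preserves-earlier {a} {c} (a-perfect , a-agree) (_ , c-agree) t t<ℓ = preserve (matchingOf t Finₚ.≟ m₀)
    where
    j : Fin n
    j = vertexOf t
    preserve : Dec (matchingOf t ≡ m₀) → switchBy a c (matchingOf t) j ≡ c (matchingOf t) j
    preserve (no other) = switch-off m₀ (revealed ℓ a) y₀ c j other
    preserve (yes same) = subst (λ m → switchBy a c m j ≡ c m j) (sym same)
      (switchBy-fixes c a-perfect j (λ j≡i₀ → ℕₚ.<-irrefl (cong toℕ (slot-injective t ℓ same j≡i₀)) t<ℓ)
        (subst (λ m → a m j ≡ ω m j) same (a-agree t t<ℓ)) (subst (λ m → c m j ≡ ω m j) same (c-agree t t<ℓ)))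

  revealed-switchBy : ∀ {a} b → Perfect a → revealed ℓ (switchBy a b) ≡ transpose (revealed ℓ a) y₀ (revealed ℓ b)
  revealed-switchBy {a} b a-perfect = trans (switch-at m₀ (revealed ℓ a) y₀ b i₀)
    (cong (transpose (revealed ℓ a) y₀ ∘ b m₀)
      (transpose-fix-distinct (revealed ℓ a) y₀ i₀ (proj₁ (a-perfect m₀ i₀) ∘ sym) (proj₁ (ω-perfect m₀ i₀) ∘ sym)))

  eS-switchBy : ∀ {a} → InC a → WithinOne (eS k a) (eS k (switchBy a a))
  eS-switchBy {a} (a-perfect , _) = eS-switch a a-perfect m₀ i₀ y₀ (vertexOf-in-S ℓ) (proj₁ (ω-perfect m₀ i₀))

  Pair : Set
  Pair = Outcome n d × Outcome n d

  InCD : Pair → Set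
  InCD (a , b) = InC a × InD b

  φ : Pair → Pair
  φ (a , b) = switchBy a b , switchBy a a

  _≈_ : Rel Pair 0ℓ
  _≈_ = Pointwise _≋_ _≋_

  _≈?_ : Decidable _≈_
  _≈?_ = ×-decidable _≋?_ _≋?_

  switchBy-resp : ∀ a a' c → revealed ℓ a ≡ revealed ℓ a' → switchBy a c ≋ switchBy a' c
  switchBy-resp a a' c same m j = cong (λ x → switch m₀ x y₀ c m j) same

  φ-maps-into : ∀ {p} → InCD p → InCD (φ p)
  φ-maps-into {a , b} (inC@(a-perfect , a-agree) , inD@(b-perfect , b-agree)) =
    (switch-perfect m₀ _ y₀ b-perfect , λ t t<ℓ →
       trans (switchBy-preserves-earlier inC (InD⇒InC inD) t t<ℓ) (proj₂ (InD⇒InC inD) t t<ℓ)) ,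
    (switch-perfect m₀ _ y₀ a-perfect , agree-through-ℓ)
    where
    agree-through-ℓ : AgreesBefore (suc (toℕ ℓ)) ω (switchBy a a)
    agree-through-ℓ t t<1+ℓ with ℕₚ.m<1+n⇒m<n∨m≡n t<1+ℓ
    ... | inj₁ t<ℓ = trans (switchBy-preserves-earlier inC inC t t<ℓ) (a-agree t t<ℓ)
    ... | inj₂ t≡ℓ with Finₚ.toℕ-injective {i = t} {j = ℓ} t≡ℓ
    ...   | refl = trans (revealed-switchBy a a-perfect) (transpose-matchˡ (revealed ℓ a) y₀)

  φ-cong : ∀ {p q} → p ≈ q → φ p ≈ φ q
  φ-cong {a , b} {a' , b'} (a≋a' , b≋b') =
    (λ m j → trans (switchBy-resp a a' b same m j) (switch-cong m₀ _ y₀ b≋b' m j)) ,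
    (λ m j → trans (switchBy-resp a a' a same m j) (switch-cong m₀ _ y₀ a≋a' m j))
    where
    same : revealed ℓ a ≡ revealed ℓ a'
    same = a≋a' m₀ i₀

  -- φ is an involution on C × D, using that Z_ℓ(b) = y₀ for b ∈ D.
  φ-involutive : ∀ {p} → InCD p → φ (φ p) ≈ p
  φ-involutive {a , b} ((a-perfect , _) , (_ , b-agree)) =
    (λ m j → trans (switchBy-resp (switchBy a b) a (switchBy a a) same m j) (switch-involutive m₀ _ y₀ a m j)) ,
    (λ m j → trans (switchBy-resp (switchBy a b) a (switchBy a b) same m j) (switch-involutive m₀ _ y₀ b m j))
    where
    same : revealed ℓ (switchBy a b) ≡ revealed ℓ a
    same = trans (revealed-switchBy b a-perfect)
      (trans (cong (transpose (revealed ℓ a) y₀) (b-agree ℓ (ℕₚ.n<1+n (toℕ ℓ)))) (transpose-matchʳ (revealed ℓ a) y₀))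

  φ-self-inverse : ∀ {p q} → InCD p → q ≈ φ p → p ≈ φ q
  φ-self-inverse {p} {q} inp q≈φp =
    (λ m j → sym (trans (proj₁ φq≈φφp m j) (proj₁ φφp≈p m j))) ,
    (λ m j → sym (trans (proj₂ φq≈φφp m j) (proj₂ φφp≈p m j)))
    where
    φq≈φφp : φ q ≈ φ (φ p)
    φq≈φφp = φ-cong q≈φp
    φφp≈p : φ (φ p) ≈ p
    φφp≈p = φ-involutive inp

  C D : List (Outcome n d)
  C = consistent (toℕ ℓ) ω
  D = consistent (suc (toℕ ℓ)) ω

  pairs : List Pair
  pairs = cartesianProduct C D

  pairs-members : ∀ {p} → p ∈ pairs → InCD p
  pairs-members = All.lookup (Allₚ.cartesianProduct⁺ (setoid _) (setoid _) C D λ a∈ b∈ →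
    All.lookup (consistent-members (toℕ ℓ) ω) a∈ , All.lookup (consistent-members (suc (toℕ ℓ)) ω) b∈)

  count-pairs : ∀ {p} → InCD p → count _≈?_ pairs p ≡ 1
  count-pairs {a , b} (inC , inD) = trans (count-cartesianProduct _≋?_ _≋?_ C D a b)
    (cong₂ _*_ (count-consistent (toℕ ℓ) ω a (proj₁ inC) (proj₂ inC)) (count-consistent (suc (toℕ ℓ)) ω b (proj₁ inD) (proj₂ inD)))

  -- Double counting along φ: the switched outcomes switchBy a a run over D as often as b does.
  reindexed : ∑[ p ∈ pairs ] eS k (proj₂ (φ p)) ≡ ∑[ p ∈ pairs ] eS k (proj₂ p)
  reindexed = ∑-reindex _≈?_ pairs φ (eS k ∘ proj₂) (eS-cong ∘ proj₂)
    (λ p∈ → count-pairs (φ-maps-into (pairs-members p∈)))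
    (λ p∈ _ → φ-self-inverse (pairs-members p∈))

  ∑-first : ∑[ p ∈ pairs ] eS k (proj₁ p) ≡ length D * ∑ C (eS k)
  ∑-first = trans (∑-cartesianProduct _ C D) (trans (∑-cong C (λ a → ∑-const (eS k a) D)) (∑-*ˡ (length D) (eS k) C))

  ∑-second : ∑[ p ∈ pairs ] eS k (proj₂ p) ≡ length C * ∑ D (eS k)
  ∑-second = trans (∑-cartesianProduct _ C D) (∑-const (∑ D (eS k)) C)

  ∑-one : ∑[ _ ∈ pairs ] 1 ≡ length C * length D
  ∑-one = trans (∑-cartesianProduct _ C D)
    (trans (∑-cong C (λ _ → trans (∑-const 1 D) (ℕₚ.*-identityʳ (length D)))) (∑-const (length D) C))

  -- Comparing each pair (a, b) with its image under φ, whose second component switchBy a a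
  -- is within one of a, bounds the two cross-multiplied totals by each other.
  cross-bound : ∀ (f g : Pair → ℕ) → (∀ {p} → InCD p → f p ≤ g p + 1) →
    ∑ pairs f ≤ ∑ pairs g + length C * length D
  cross-bound f g f≤g+1 = begin
      ∑ pairs f                                       ≤⟨ ∑-mono pairs (All.tabulate (f≤g+1 ∘ pairs-members)) ⟩
      ∑[ p ∈ pairs ] (g p + 1)                        ≡⟨ ∑-+ g (λ _ → 1) pairs ⟩
      ∑ pairs g + ∑[ _ ∈ pairs ] 1                    ≡⟨ cong (∑ pairs g +_) ∑-one ⟩
      ∑ pairs g + length C * length D                 ∎
    where open ℕₚ.≤-Reasoning

  cross-bound₁ : length D * ∑ C (eS k) ≤ length C * ∑ D (eS k) + length C * length D
  cross-bound₁ = subst₂ (λ u v → u ≤ v + length C * length D) ∑-first (trans reindexed ∑-second)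
    (cross-bound (eS k ∘ proj₁) (eS k ∘ proj₂ ∘ φ) (proj₁ ∘ eS-switchBy ∘ proj₁))

  cross-bound₂ : length C * ∑ D (eS k) ≤ length D * ∑ C (eS k) + length C * length D
  cross-bound₂ = subst₂ (λ u v → u ≤ v + length C * length D) (trans reindexed ∑-second) ∑-first
    (cross-bound (eS k ∘ proj₂ ∘ φ) (eS k ∘ proj₁) (proj₂ ∘ eS-switchBy ∘ proj₁))

  -- ω itself is consistent with its own reveals, so C and D are nonempty.
  nonempty : ∀ j → AgreesBefore j ω ω → 1 ≤ length (map (eS k) (consistent j ω))
  nonempty j agree with consistent j ω | count-consistent j ω ω ω-perfect agree
  ... | _ ∷ _ | _ = s≤s z≤n

  increment-bound : ∣ X n d k enum (suc (toℕ ℓ)) ω - X n d k enum (toℕ ℓ) ω ∣ ℚ.≤ 1ℚ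
  increment-bound = mean-within-one (map (eS k) C) (map (eS k) D)
    (nonempty (toℕ ℓ) (λ _ _ → refl)) (nonempty (suc (toℕ ℓ)) (λ _ _ → refl))
    (subst₂ (λ c d → d * ∑ C (eS k) ≤ c * ∑ D (eS k) + c * d) (sym (length-map (eS k) C)) (sym (length-map (eS k) D)) cross-bound₁)
    (subst₂ (λ c d → c * ∑ D (eS k) ≤ d * ∑ C (eS k) + c * d) (sym (length-map (eS k) C)) (sym (length-map (eS k) D)) cross-bound₂)

-- The theorem: apply the switching argument at step ℓ.
mainTheorem9 : (n d k : ℕ) → 2 ∣ n → 1 ≤ d → 2 * k < n →
    (enum : Fin (d * (k ∸ 1)) ↔ (Fin d × Fin (k ∸ 1))) →
    (ω : Outcome n d) → (∀ m → IsPerfectMatching (ω m)) →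
    (ℓ : Fin (d * (k ∸ 1))) →
    ∣ X n d k enum (suc (toℕ ℓ)) ω - X n d k enum (toℕ ℓ) ω ∣ ℚ.≤ 1ℚ
mainTheorem9 n d k _ _ 2k<n enum ω ω-perfect ℓ = Switching.increment-bound n d k k-1<n enum ω ω-perfect ℓ
  where
  k-1<n : k ∸ 1 < n
  k-1<n = ℕₚ.≤-<-trans (ℕₚ.m∸n≤m k 1) (ℕₚ.≤-<-trans (ℕₚ.m≤m+n k (k + 0)) 2k<n)
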